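{- We have $T_2(k,k)=(P_k)!$, and for integers $k\ge1$ and $N\ge k+1$, $$T_2(N,k)=(P_k)!\,(1+\theta^2P_{k-1})(1+\theta^2P_k)\cdots(1+\theta^2P_{N-2}).$$
   Context: Let $\theta>0$. $\mathrm{inv}(\pi)$ is the number of pairs $i<j$ with $\pi_i>\pi_j$. $P_n=1+\theta+\cdots+\theta^{n-1}$ ($P_0=0$), $(P_n)!=P_nP_{n-1}\cdots P_1$, $(P_0)!=1$. For $\pi\in S_n$, position $i$ is a left-to-right second maximum if exactly one $j<i$ has $\pi_j>\pi_i$. $\pi$ is $k$-pickable if some position $i>k$ is a left-to-right second maximum (i.e. the strategy rejecting the first $k$ candidates and accepting the next left-to-right second maximum makes a selection). $T_2(n,k)=\sum_{\pi\in S_n\text{ not }k\text{ -pickable}}\theta^{\mathrm{inv}(\pi)}$. -}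

module Defs where

open import Data.Nat using (ℕ; zero; suc; _<ᵇ_; _≡ᵇ_)
open import Data.Bool using (Bool; true; false; _∧_; _∨_; not; if_then_else_)
open import Data.Fin using (Fin; toℕ)
open import Data.List using (List; []; _∷_; map; concatMap; filter; foldr; allFin)
open import Data.Bool.ListAction using (and; or)
open import Data.Vec using (Vec; []; _∷_; lookup)
open import Relation.Nullary.Decidable using (Dec)
open import Data.Bool.Properties using (T?)
open import Algebra.Bundles using (CommutativeSemiring)

count : {A : Set} → (A → Bool) → List A → ℕ
count p [] = 0
count p (x ∷ xs) = if p x then suc (count p xs) else count p xs

allVecs : (n m : ℕ) → List (Vec (Fin n) m)
allVecs n zero = [] ∷ []
allVecs n (suc m) = concatMap (λ i → map (i ∷_) (allVecs n m)) (allFin n)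

-- One-line notation π = (π_0,…,π_{n-1}) (0-indexed positions and values).
-- π is a permutation iff its entries are pairwise distinct.
isPerm : {n : ℕ} → Vec (Fin n) n → Bool
isPerm {n} π = and (map (λ i → and (map (λ j →
    not (toℕ i <ᵇ toℕ j) ∨ not (toℕ (lookup π i) ≡ᵇ toℕ (lookup π j))) (allFin n))) (allFin n))

Sym : (n : ℕ) → List (Vec (Fin n) n)
Sym n = filter (λ π → T? (isPerm π)) (allVecs n n)

inv : {n : ℕ} → Vec (Fin n) n → ℕ
inv {n} π = count (λ i → true) (concatMap (λ i → concatMap (λ j →
    if (toℕ i <ᵇ toℕ j) ∧ (toℕ (lookup π j) <ᵇ toℕ (lookup π i)) then (i ∷ []) else [])
    (allFin n)) (allFin n))

isLR2 : {n : ℕ} → Vec (Fin n) n → Fin n → Bool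
isLR2 {n} π i = count (λ j → (toℕ j <ᵇ toℕ i) ∧ (toℕ (lookup π i) <ᵇ toℕ (lookup π j))) (allFin n) ≡ᵇ 1

-- π is k-pickable iff some position i > k (1-indexed), i.e. 0-indexed index ≥ k,
-- is a left-to-right second maximum.
pickable : {n : ℕ} → ℕ → Vec (Fin n) n → Bool
pickable {n} k π = or (map (λ i → not (toℕ i <ᵇ k) ∧ isLR2 π i) (allFin n))

module _ {c ℓ} (R : CommutativeSemiring c ℓ) where
  open CommutativeSemiring R

  sumR : List Carrier → Carrier
  sumR = foldr _+_ 0#

  pow : Carrier → ℕ → Carrier
  pow θ zero = 1#
  pow θ (suc m) = θ * pow θ m

  P : Carrier → ℕ → Carrier
  P θ zero = 0#
  P θ (suc m) = P θ m + pow θ m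

  Pfact : Carrier → ℕ → Carrier
  Pfact θ zero = 1#
  Pfact θ (suc m) = P θ (suc m) * Pfact θ m

  T2 : Carrier → ℕ → ℕ → Carrier
  T2 θ n k = sumR (map (λ π → pow θ (inv π)) (filter (λ π → T? (not (pickable k π))) (Sym n)))

  prodR : ℕ → (ℕ → Carrier) → Carrier
  prodR zero f = 1#
  prodR (suc m) f = prodR m f * f m

module Submission where

-- Permutations are built by appending one letter at a time. An injective word of length m + 1 with
-- letters in a set S of size m + 1 is r ∷ʳ x, where r is such a word of length m for S ∖ x. Appending x
-- adds as many inversions as r has entries above x; since r lists all of S ∖ x, this is the number g
-- of elements of S above x, and the new position m (counting from 0) is a left-to-right second
-- maximum iff g = 1. As x runs over S, g runs over 0, …, m exactly once, so the θ^inv-weighted count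
-- of non-k-pickable words is multiplicative: position j contributes Σ_{g ≤ j} θ^g = P_{j+1} if j < k,
-- and the same sum without the term g = 1, that is 1 + θ² P_{j-1}, if j ≥ k.

open import Defs
open import Data.Nat as ℕ using (ℕ; _≤_; _∸_)
open import Data.Product using (_×_; _,_)
open import Algebra.Bundles using (CommutativeSemiring)

open import Algebra.Bundles using (CommutativeMonoid)
open import Data.Bool using (Bool; true; false; T; _∧_; _∨_; not; if_then_else_)
open import Data.Bool.Properties
  using (T?; T-≡; ∧-commutativeMonoid; ∨-commutativeMonoid; ∧-zeroʳ; ∧-identityʳ; ∧-conicalˡ; ∧-conicalʳ)
open import Data.Bool.ListAction using (and; or)
open import Data.Fin using (Fin; zero; suc; toℕ; inject₁; fromℕ; punchIn)
open import Data.Fin.Properties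
  using (toℕ-inject₁; toℕ-fromℕ; toℕ<n; toℕ≤pred[n]; toℕ-injective; punchInᵢ≢i)
open import Data.List using (List; []; _∷_; _++_; map; concatMap; foldr; filter; tabulate; allFin)
open import Data.List.Properties using (map-++; map-∘)
open import Data.Nat using (zero; suc; _<_; _<ᵇ_; _≡ᵇ_; z≤n)
open import Data.Nat.Properties using (+-0-commutativeMonoid; <ᵇ⇒<; <⇒<ᵇ; ≤⇒≯; ≡⇒≡ᵇ; ≡ᵇ⇒≡)
import Data.Nat.Properties as ℕₚ
open import Data.Unit using (tt)
open import Data.Vec using (Vec; []; _∷_; _∷ʳ_; lookup; initLast)
open import Function using (_∘_; id; Equivalence)
open import Relation.Binary.PropositionalEquality
  using (_≡_; _≢_; refl; sym; trans; cong; cong₂; subst; module ≡-Reasoning)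
open import Relation.Nullary.Negation using (contradiction)

private variable
  A B : Set
  m n : ℕ

lookup-∷ʳ-inject₁ : ∀ (r : Vec A m) x i → lookup (r ∷ʳ x) (inject₁ i) ≡ lookup r i
lookup-∷ʳ-inject₁ (a ∷ r) x zero    = refl
lookup-∷ʳ-inject₁ (a ∷ r) x (suc i) = lookup-∷ʳ-inject₁ r x i

lookup-∷ʳ-fromℕ : ∀ (r : Vec A m) x → lookup (r ∷ʳ x) (fromℕ m) ≡ x
lookup-∷ʳ-fromℕ []      x = refl
lookup-∷ʳ-fromℕ (a ∷ r) x = lookup-∷ʳ-fromℕ r x

<ᵇ-true : ∀ {i j} → i < j → (i <ᵇ j) ≡ true
<ᵇ-true i<j = Equivalence.to T-≡ (<⇒<ᵇ i<j)

<ᵇ-false : ∀ {i j} → j ≤ i → (i <ᵇ j) ≡ false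
<ᵇ-false {i} {j} j≤i with i <ᵇ j in eq
... | false = refl
... | true  = contradiction (<ᵇ⇒< i j (subst T (sym eq) tt)) (≤⇒≯ j≤i)

≡ᵇ-refl : ∀ i → (i ≡ᵇ i) ≡ true
≡ᵇ-refl i = Equivalence.to T-≡ (≡⇒≡ᵇ i i refl)

inject₁<ᵇfromℕ : ∀ (i : Fin m) → (toℕ (inject₁ i) <ᵇ toℕ (fromℕ m)) ≡ true
inject₁<ᵇfromℕ {m} i rewrite toℕ-inject₁ i | toℕ-fromℕ m = <ᵇ-true (toℕ<n i)

fromℕ≮ᵇ : ∀ (j : Fin (suc m)) → (toℕ (fromℕ m) <ᵇ toℕ j) ≡ false
fromℕ≮ᵇ {m} j rewrite toℕ-fromℕ m = <ᵇ-false (toℕ≤pred[n] j)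

module FinSum {c ℓ} (M : CommutativeMonoid c ℓ) where
  open CommutativeMonoid M hiding (refl; sym) renaming (trans to ≈-trans)
  open import Algebra.Properties.CommutativeMonoid.Sum M public

  foldr-map-tabulate : ∀ (f : A → Carrier) (g : Fin n → A) →
                       foldr _∙_ ε (map f (tabulate g)) ≡ sum (f ∘ g)
  foldr-map-tabulate {n = zero}  f g = refl
  foldr-map-tabulate {n = suc n} f g = cong (f (g zero) ∙_) (foldr-map-tabulate f (g ∘ suc))

  sum-lookup-∷ʳ : ∀ (f : A → Carrier) (r : Vec A m) x →
                  sum (λ j → f (lookup (r ∷ʳ x) j)) ≈ sum (λ j → f (lookup r j)) ∙ f x
  sum-lookup-∷ʳ f r x = ≈-trans (sum-init-last (f ∘ lookup (r ∷ʳ x))) (∙-cong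
    (reflexive (sum-cong-≗ (cong f ∘ lookup-∷ʳ-inject₁ r x)))
    (reflexive (cong f (lookup-∷ʳ-fromℕ r x))))

  pairwise : (Bool → A → A → Carrier) → Vec A m → Carrier
  pairwise g w = sum (λ i → sum (λ j → g (toℕ i <ᵇ toℕ j) (lookup w i) (lookup w j)))

  pairwise-∷ʳ : ∀ (g : Bool → A → A → Carrier) → (∀ u v → g false u v ≈ ε) → ∀ (r : Vec A m) x →
                pairwise g (r ∷ʳ x) ≈ pairwise g r ∙ sum (λ i → g true (lookup r i) x)
  pairwise-∷ʳ {A = A} {m = m} g g-false r x = begin
    sum row                                            ≈⟨ sum-init-last row ⟩
    sum (row ∘ inject₁) ∙ row (fromℕ m)                ≈⟨ ∙-cong (sum-cong-≋ row-inject₁) row-fromℕ ⟩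
    sum (λ i → sum (entry r i) ∙ last-column i) ∙ ε    ≈⟨ identityʳ _ ⟩
    sum (λ i → sum (entry r i) ∙ last-column i)        ≈⟨ ∑-distrib-+ (sum ∘ entry r) last-column ⟩
    pairwise g r ∙ sum last-column                     ∎
    where
    open import Relation.Binary.Reasoning.Setoid setoid
    entry : ∀ {k} → Vec A k → Fin k → Fin k → Carrier
    entry w i j = g (toℕ i <ᵇ toℕ j) (lookup w i) (lookup w j)
    row : Fin (suc m) → Carrier
    row i = sum (entry (r ∷ʳ x) i)
    last-column : Fin m → Carrier
    last-column i = g true (lookup r i) x
    entry-inject₁ : ∀ i j → entry (r ∷ʳ x) (inject₁ i) (inject₁ j) ≡ entry r i j
    entry-inject₁ i j rewrite toℕ-inject₁ i | toℕ-inject₁ j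
      | lookup-∷ʳ-inject₁ r x i | lookup-∷ʳ-inject₁ r x j = refl
    entry-fromℕ : ∀ i → entry (r ∷ʳ x) (inject₁ i) (fromℕ m) ≡ last-column i
    entry-fromℕ i rewrite inject₁<ᵇfromℕ i | lookup-∷ʳ-inject₁ r x i | lookup-∷ʳ-fromℕ r x = refl
    row-inject₁ : ∀ i → row (inject₁ i) ≈ sum (entry r i) ∙ last-column i
    row-inject₁ i = ≈-trans (sum-init-last (entry (r ∷ʳ x) (inject₁ i)))
      (∙-cong (reflexive (sum-cong-≗ (entry-inject₁ i))) (reflexive (entry-fromℕ i)))
    last-entry : ∀ j → entry (r ∷ʳ x) (fromℕ m) j ≈ ε
    last-entry j =
      ≈-trans (reflexive (cong (λ b → g b (lookup w (fromℕ m)) (lookup w j)) (fromℕ≮ᵇ j))) (g-false _ _)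
      where w = r ∷ʳ x
    row-fromℕ : row (fromℕ m) ≈ ε
    row-fromℕ = ≈-trans (sum-cong-≋ last-entry) (sum-replicate-zero (suc m))

module ℕΣ = FinSum +-0-commutativeMonoid
module ∧Σ = FinSum ∧-commutativeMonoid
module ∨Σ = FinSum ∨-commutativeMonoid

module Words where
  open import Data.Nat using (_+_)
  open import Data.Nat.Properties
    using (+-comm; +-identityʳ; suc-injective; ≤-refl; ≤-reflexive; ≤-trans; ≤-antisym;
           +-monoˡ-≤; +-monoʳ-≤; +-cancelʳ-≤; module ≤-Reasoning)

  bit : Bool → ℕ
  bit true  = 1
  bit false = 0

  ∣_∣ : (Fin n → Bool) → ℕ
  ∣ P ∣ = ℕΣ.sum (bit ∘ P)

  ∣∣-cong : ∀ {P Q : Fin n → Bool} → (∀ z → P z ≡ Q z) → ∣ P ∣ ≡ ∣ Q ∣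
  ∣∣-cong P≡Q = ℕΣ.sum-cong-≗ (cong bit ∘ P≡Q)

  _<ᶠ_ _≠ᶠ_ : Fin n → Fin n → Bool
  i <ᶠ j = toℕ i <ᵇ toℕ j
  i ≠ᶠ j = not (toℕ i ≡ᵇ toℕ j)

  _∩_ : (Fin n → Bool) → (Fin n → Bool) → Fin n → Bool
  (P ∩ Q) z = P z ∧ Q z

  _∖_ : (Fin n → Bool) → Fin n → Fin n → Bool
  S ∖ y = S ∩ (_≠ᶠ y)

  count-tabulate : ∀ (p : A → Bool) (g : Fin n → A) → count p (tabulate g) ≡ ∣ p ∘ g ∣
  count-tabulate {n = zero}  p g = refl
  count-tabulate {n = suc n} p g with p (g zero)
  ... | true  = cong suc (count-tabulate p (g ∘ suc))
  ... | false = count-tabulate p (g ∘ suc)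

  count-allFin-init-last : ∀ (p : Fin (suc m) → Bool) →
                           count p (allFin (suc m)) ≡ ∣ p ∘ inject₁ ∣ + bit (p (fromℕ m))
  count-allFin-init-last p = trans (count-tabulate p id) (ℕΣ.sum-init-last (bit ∘ p))

  count-++ : ∀ (p : A → Bool) xs ys → count p (xs ++ ys) ≡ count p xs + count p ys
  count-++ p []       ys = refl
  count-++ p (x ∷ xs) ys with p x
  ... | true  = cong suc (count-++ p xs ys)
  ... | false = count-++ p xs ys

  count-concatMap-tabulate : ∀ (p : B → Bool) (f : A → List B) (g : Fin n → A) →
                             count p (concatMap f (tabulate g)) ≡ ℕΣ.sum (λ i → count p (f (g i)))
  count-concatMap-tabulate {n = zero}  p f g = refl
  count-concatMap-tabulate {n = suc n} p f g = trans (count-++ p (f (g zero)) _)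
    (cong (count p (f (g zero)) +_) (count-concatMap-tabulate p f (g ∘ suc)))

  -- The notions of Defs for words of length m over the alphabet Fin n; for m = n they unfold to
  -- inv, isPerm, isLR2 and pickable.
  inv′ : Vec (Fin n) m → ℕ
  inv′ {m = m} π = count (λ i → true) (concatMap (λ i → concatMap (λ j →
      if (toℕ i <ᵇ toℕ j) ∧ (toℕ (lookup π j) <ᵇ toℕ (lookup π i)) then (i ∷ []) else [])
      (allFin m)) (allFin m))

  isPerm′ : Vec (Fin n) m → Bool
  isPerm′ {m = m} π = and (map (λ i → and (map (λ j →
      not (toℕ i <ᵇ toℕ j) ∨ not (toℕ (lookup π i) ≡ᵇ toℕ (lookup π j))) (allFin m))) (allFin m))

  earlierAndLarger : Vec (Fin n) m → Fin m → Fin m → Bool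
  earlierAndLarger π i j = (toℕ j <ᵇ toℕ i) ∧ (toℕ (lookup π i) <ᵇ toℕ (lookup π j))

  higherBefore : Vec (Fin n) m → Fin m → ℕ
  higherBefore {m = m} π i = count (earlierAndLarger π i) (allFin m)

  pickable′ : ℕ → Vec (Fin n) m → Bool
  pickable′ {m = m} k π = or (map (λ i → not (toℕ i <ᵇ k) ∧ (higherBefore π i ≡ᵇ 1)) (allFin m))

  allIn : (Fin n → Bool) → Vec (Fin n) m → Bool
  allIn S w = ∧Σ.sum (S ∘ lookup w)

  occurrences : (Fin n → Bool) → Vec (Fin n) m → ℕ
  occurrences p w = ∣ p ∘ lookup w ∣

  injectsInto : (Fin n → Bool) → Vec (Fin n) m → Bool
  injectsInto S w = isPerm′ w ∧ allIn S w

  allIn-∷ʳ : ∀ S (r : Vec (Fin n) m) x → allIn S (r ∷ʳ x) ≡ allIn S r ∧ S x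
  allIn-∷ʳ S = ∧Σ.sum-lookup-∷ʳ S

  allIn-∩ : ∀ P Q (r : Vec (Fin n) m) → allIn (P ∩ Q) r ≡ allIn P r ∧ allIn Q r
  allIn-∩ P Q r = ∧Σ.∑-distrib-+ (P ∘ lookup r) (Q ∘ lookup r)

  occurrences-∷ʳ : ∀ p (r : Vec (Fin n) m) x → occurrences p (r ∷ʳ x) ≡ occurrences p r + bit (p x)
  occurrences-∷ʳ p = ℕΣ.sum-lookup-∷ʳ (bit ∘ p)

  inversion : Bool → Fin n → Fin n → ℕ
  inversion before u v = bit (before ∧ (v <ᶠ u))

  distinct : Bool → Fin n → Fin n → Bool
  distinct before u v = not before ∨ (u ≠ᶠ v)

  inv′-pairwise : ∀ (w : Vec (Fin n) m) → inv′ w ≡ ℕΣ.pairwise inversion w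
  inv′-pairwise {m = m} w = trans (count-concatMap-tabulate _ (λ i → concatMap (cell i) (allFin m)) id)
    (ℕΣ.sum-cong-≗ λ i → trans (count-concatMap-tabulate _ (cell i) id)
      (ℕΣ.sum-cong-≗ λ j → count-cell (inverted i j) i))
    where
    inverted : Fin m → Fin m → Bool
    inverted i j = (toℕ i <ᵇ toℕ j) ∧ (toℕ (lookup w j) <ᵇ toℕ (lookup w i))
    cell : Fin m → Fin m → List (Fin m)
    cell i j = if inverted i j then (i ∷ []) else []
    count-cell : ∀ b (i : Fin m) → count (λ _ → true) (if b then i ∷ [] else []) ≡ bit b
    count-cell true  i = refl
    count-cell false i = refl

  isPerm′-pairwise : ∀ (w : Vec (Fin n) m) → isPerm′ w ≡ ∧Σ.pairwise distinct w
  isPerm′-pairwise {m = m} w =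
    trans (∧Σ.foldr-map-tabulate row id) (∧Σ.sum-cong-≗ λ i → ∧Σ.foldr-map-tabulate (entry i) id)
    where
    entry : Fin m → Fin m → Bool
    entry i j = distinct (toℕ i <ᵇ toℕ j) (lookup w i) (lookup w j)
    row : Fin m → Bool
    row i = and (map (entry i) (allFin m))

  inv′-∷ʳ : ∀ (r : Vec (Fin n) m) x → inv′ (r ∷ʳ x) ≡ inv′ r + occurrences (x <ᶠ_) r
  inv′-∷ʳ r x = begin
    inv′ (r ∷ʳ x)                                    ≡⟨ inv′-pairwise (r ∷ʳ x) ⟩
    ℕΣ.pairwise inversion (r ∷ʳ x)                   ≡⟨ ℕΣ.pairwise-∷ʳ inversion (λ _ _ → refl) r x ⟩
    ℕΣ.pairwise inversion r + occurrences (x <ᶠ_) r  ≡⟨ cong (_+ occurrences (x <ᶠ_) r) (inv′-pairwise r) ⟨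
    inv′ r + occurrences (x <ᶠ_) r                   ∎
    where open ≡-Reasoning

  isPerm′-∷ʳ : ∀ (r : Vec (Fin n) m) x → isPerm′ (r ∷ʳ x) ≡ isPerm′ r ∧ allIn (_≠ᶠ x) r
  isPerm′-∷ʳ r x = begin
    isPerm′ (r ∷ʳ x)                           ≡⟨ isPerm′-pairwise (r ∷ʳ x) ⟩
    ∧Σ.pairwise distinct (r ∷ʳ x)              ≡⟨ ∧Σ.pairwise-∷ʳ distinct (λ _ _ → refl) r x ⟩
    ∧Σ.pairwise distinct r ∧ allIn (_≠ᶠ x) r   ≡⟨ cong (_∧ allIn (_≠ᶠ x) r) (isPerm′-pairwise r) ⟨
    isPerm′ r ∧ allIn (_≠ᶠ x) r                ∎
    where open ≡-Reasoning

  injectsInto-∷ʳ : ∀ S (r : Vec (Fin n) m) x → injectsInto S (r ∷ʳ x) ≡ S x ∧ injectsInto (S ∖ x) r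
  injectsInto-∷ʳ S r x = begin
    isPerm′ (r ∷ʳ x) ∧ allIn S (r ∷ʳ x)
      ≡⟨ cong₂ _∧_ (isPerm′-∷ʳ r x) (allIn-∷ʳ S r x) ⟩
    (isPerm′ r ∧ allIn (_≠ᶠ x) r) ∧ (allIn S r ∧ S x)
      ≡⟨ reorder (isPerm′ r) (allIn (_≠ᶠ x) r) (allIn S r) (S x) ⟩
    S x ∧ (isPerm′ r ∧ (allIn S r ∧ allIn (_≠ᶠ x) r))
      ≡⟨ cong (λ b → S x ∧ (isPerm′ r ∧ b)) (allIn-∩ S (_≠ᶠ x) r) ⟨
    S x ∧ injectsInto (S ∖ x) r ∎
    where
    open ≡-Reasoning
    open import Algebra.Solver.CommutativeMonoid ∧-commutativeMonoid using (solve; _⊕_; _⊜_)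
    reorder : ∀ p q a s → (p ∧ q) ∧ (a ∧ s) ≡ s ∧ (p ∧ (a ∧ q))
    reorder = solve 4 (λ p q a s → (p ⊕ q) ⊕ (a ⊕ s) ⊜ s ⊕ (p ⊕ (a ⊕ q))) refl

  higherBefore-∷ʳ-inject₁ : ∀ (r : Vec (Fin n) m) x i →
                            higherBefore (r ∷ʳ x) (inject₁ i) ≡ higherBefore r i
  higherBefore-∷ʳ-inject₁ {m = m} r x i = begin
    count e (allFin (suc m))                  ≡⟨ count-allFin-init-last e ⟩
    ∣ e ∘ inject₁ ∣ + bit (e (fromℕ m))       ≡⟨ cong₂ _+_ (∣∣-cong e-inject₁) (cong bit e-fromℕ) ⟩
    ∣ earlierAndLarger r i ∣ + 0              ≡⟨ +-identityʳ _ ⟩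
    ∣ earlierAndLarger r i ∣                  ≡⟨ count-tabulate (earlierAndLarger r i) id ⟨
    count (earlierAndLarger r i) (allFin m)   ∎
    where
    open ≡-Reasoning
    e = earlierAndLarger (r ∷ʳ x) (inject₁ i)
    e-inject₁ : ∀ j → e (inject₁ j) ≡ earlierAndLarger r i j
    e-inject₁ j rewrite toℕ-inject₁ i | toℕ-inject₁ j
      | lookup-∷ʳ-inject₁ r x i | lookup-∷ʳ-inject₁ r x j = refl
    e-fromℕ : e (fromℕ m) ≡ false
    e-fromℕ rewrite fromℕ≮ᵇ (inject₁ i) = refl

  higherBefore-∷ʳ-fromℕ : ∀ (r : Vec (Fin n) m) x →
                          higherBefore (r ∷ʳ x) (fromℕ m) ≡ occurrences (x <ᶠ_) r
  higherBefore-∷ʳ-fromℕ {m = m} r x = begin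
    count e (allFin (suc m))                  ≡⟨ count-allFin-init-last e ⟩
    ∣ e ∘ inject₁ ∣ + bit (e (fromℕ m))       ≡⟨ cong₂ _+_ (∣∣-cong e-inject₁) (cong bit e-fromℕ) ⟩
    occurrences (x <ᶠ_) r + 0                 ≡⟨ +-identityʳ _ ⟩
    occurrences (x <ᶠ_) r                     ∎
    where
    open ≡-Reasoning
    e = earlierAndLarger (r ∷ʳ x) (fromℕ m)
    e-inject₁ : ∀ j → e (inject₁ j) ≡ (x <ᶠ lookup r j)
    e-inject₁ j rewrite inject₁<ᵇfromℕ j | lookup-∷ʳ-fromℕ r x | lookup-∷ʳ-inject₁ r x j = refl
    e-fromℕ : e (fromℕ m) ≡ false
    e-fromℕ rewrite fromℕ≮ᵇ (fromℕ m) = refl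

  pickable′-∷ʳ : ∀ k (r : Vec (Fin n) m) x →
                 pickable′ k (r ∷ʳ x) ≡ pickable′ k r ∨ (not (m <ᵇ k) ∧ (occurrences (x <ᶠ_) r ≡ᵇ 1))
  pickable′-∷ʳ {m = m} k r x = begin
    pickable′ k (r ∷ʳ x)
      ≡⟨ ∨Σ.foldr-map-tabulate (pickAt (r ∷ʳ x)) id ⟩
    ∨Σ.sum (pickAt (r ∷ʳ x))
      ≡⟨ ∨Σ.sum-init-last (pickAt (r ∷ʳ x)) ⟩
    ∨Σ.sum (pickAt (r ∷ʳ x) ∘ inject₁) ∨ pickAt (r ∷ʳ x) (fromℕ m)
      ≡⟨ cong₂ _∨_ (∨Σ.sum-cong-≗ pickAt-inject₁) pickAt-fromℕ ⟩
    ∨Σ.sum (pickAt r) ∨ picksLast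
      ≡⟨ cong (_∨ picksLast) (∨Σ.foldr-map-tabulate (pickAt r) id) ⟨
    pickable′ k r ∨ picksLast ∎
    where
    open ≡-Reasoning
    picksLast = not (m <ᵇ k) ∧ (occurrences (x <ᶠ_) r ≡ᵇ 1)
    picks : ℕ → ℕ → Bool
    picks position higher = not (position <ᵇ k) ∧ (higher ≡ᵇ 1)
    pickAt : ∀ {l} → Vec (Fin n) l → Fin l → Bool
    pickAt w i = picks (toℕ i) (higherBefore w i)
    pickAt-inject₁ : ∀ i → pickAt (r ∷ʳ x) (inject₁ i) ≡ pickAt r i
    pickAt-inject₁ i = cong₂ picks (toℕ-inject₁ i) (higherBefore-∷ʳ-inject₁ r x i)
    pickAt-fromℕ : pickAt (r ∷ʳ x) (fromℕ m) ≡ picksLast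
    pickAt-fromℕ = cong₂ picks (toℕ-fromℕ m) (higherBefore-∷ʳ-fromℕ r x)

  ≠ᶠ-true : ∀ {i j : Fin n} → i ≢ j → (i ≠ᶠ j) ≡ true
  ≠ᶠ-true {i = i} {j} i≢j with toℕ i ≡ᵇ toℕ j in eq
  ... | false = refl
  ... | true  = contradiction (toℕ-injective (≡ᵇ⇒≡ (toℕ i) (toℕ j) (subst T (sym eq) tt))) i≢j

  ∣∣-remove : ∀ (P : Fin n → Bool) y → ∣ P ∣ ≡ ∣ P ∖ y ∣ + bit (P y)
  ∣∣-remove {n = suc n} P y = begin
    ∣ P ∣                                        ≡⟨ ℕΣ.sum-remove {i = y} (bit ∘ P) ⟩
    bit (P y) + rest P                           ≡⟨ +-comm (bit (P y)) (rest P) ⟩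
    rest P + bit (P y)                           ≡⟨ cong (_+ bit (P y)) P∖y-split ⟨
    bit ((P ∖ y) y) + rest (P ∖ y) + bit (P y)   ≡⟨ cong (_+ bit (P y)) (ℕΣ.sum-remove {i = y} (bit ∘ (P ∖ y))) ⟨
    ∣ P ∖ y ∣ + bit (P y)                        ∎
    where
    open ≡-Reasoning
    rest : (Fin (suc n) → Bool) → ℕ
    rest Q = ∣ Q ∘ punchIn y ∣
    elsewhere : ∀ j → (P ∖ y) (punchIn y j) ≡ P (punchIn y j)
    elsewhere j = trans (cong (P (punchIn y j) ∧_) (≠ᶠ-true (punchInᵢ≢i y j))) (∧-identityʳ _)
    at-y : (P ∖ y) y ≡ false
    at-y = trans (cong (λ b → P y ∧ not b) (≡ᵇ-refl (toℕ y))) (∧-zeroʳ (P y))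
    P∖y-split : bit ((P ∖ y) y) + rest (P ∖ y) ≡ rest P
    P∖y-split = cong₂ _+_ (cong bit at-y) (∣∣-cong elsewhere)

  ∣∣-split : ∀ (P Q : Fin n → Bool) → ∣ P ∩ Q ∣ + ∣ P ∩ (not ∘ Q) ∣ ≡ ∣ P ∣
  ∣∣-split P Q = trans (sym (ℕΣ.∑-distrib-+ (bit ∘ (P ∩ Q)) (bit ∘ (P ∩ (not ∘ Q)))))
                       (ℕΣ.sum-cong-≗ λ z → bit-split (P z) (Q z))
    where
    bit-split : ∀ p q → bit (p ∧ q) + bit (p ∧ not q) ≡ bit p
    bit-split true  true  = refl
    bit-split true  false = refl
    bit-split false q     = refl

  ∣all∣ : ∀ n → ∣ (λ (_ : Fin n) → true) ∣ ≡ n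
  ∣all∣ zero    = refl
  ∣all∣ (suc n) = cong suc (∣all∣ n)

  ∖-∩-comm : ∀ (P Q : Fin n → Bool) y z → ((P ∩ Q) ∖ y) z ≡ ((P ∖ y) ∩ Q) z
  ∖-∩-comm P Q y z = xy∙z≈xz∙y (P z) (Q z) (z ≠ᶠ y)
    where
    open import Algebra.Properties.CommutativeSemigroup
      (CommutativeMonoid.commutativeSemigroup ∧-commutativeMonoid) using (xy∙z≈xz∙y)

  ∣∖∣ : ∀ (S : Fin n → Bool) {x} → S x ≡ true → ∣ S ∣ ≡ suc m → ∣ S ∖ x ∣ ≡ m
  ∣∖∣ S {x} Sx ∣S∣ = suc-injective (begin
    suc ∣ S ∖ x ∣            ≡⟨ +-comm 1 ∣ S ∖ x ∣ ⟩
    ∣ S ∖ x ∣ + bit true     ≡⟨ cong (λ b → ∣ S ∖ x ∣ + bit b) Sx ⟨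
    ∣ S ∖ x ∣ + bit (S x)    ≡⟨ ∣∣-remove S x ⟨
    ∣ S ∣                    ≡⟨ ∣S∣ ⟩
    suc _                    ∎)
    where open ≡-Reasoning

  occurrences-≤ : ∀ (r : Vec (Fin n) m) T p → injectsInto T r ≡ true → occurrences p r ≤ ∣ T ∩ p ∣
  occurrences-≤ {m = zero}  [] T p _   = z≤n
  occurrences-≤ {m = suc m} r  T p inj with initLast r
  ... | r′ , y , refl = begin
    occurrences p (r′ ∷ʳ y)
      ≡⟨ occurrences-∷ʳ p r′ y ⟩
    occurrences p r′ + bit (p y)
      ≤⟨ +-monoˡ-≤ (bit (p y)) (occurrences-≤ r′ (T ∖ y) p inj-r′) ⟩
    ∣ (T ∖ y) ∩ p ∣ + bit (p y)
      ≡⟨ cong₂ _+_ (∣∣-cong (∖-∩-comm T p y)) (cong (λ b → bit (b ∧ p y)) Ty) ⟨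
    ∣ (T ∩ p) ∖ y ∣ + bit (T y ∧ p y)
      ≡⟨ ∣∣-remove (T ∩ p) y ⟨
    ∣ T ∩ p ∣ ∎
    where
    open ≤-Reasoning
    inj′ : T y ∧ injectsInto (T ∖ y) r′ ≡ true
    inj′ = trans (sym (injectsInto-∷ʳ T r′ y)) inj
    Ty = ∧-conicalˡ (T y) _ inj′
    inj-r′ = ∧-conicalʳ (T y) _ inj′

  -- The bounds for p and for not ∘ p add up to the same total m on both sides, so both are equalities.
  occurrences-≡ : ∀ (r : Vec (Fin n) m) T p → injectsInto T r ≡ true → ∣ T ∣ ≡ m →
                  occurrences p r ≡ ∣ T ∩ p ∣
  occurrences-≡ {m = m} r T p inj ∣T∣ = ≤-antisym (occurrences-≤ r T p inj)
    (+-cancelʳ-≤ (occurrences (not ∘ p) r) _ _ (≤-trans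
      (+-monoʳ-≤ ∣ T ∩ p ∣ (occurrences-≤ r T (not ∘ p) inj))
      (≤-reflexive (trans in-T (sym in-r)))))
    where
    in-r : occurrences p r + occurrences (not ∘ p) r ≡ m
    in-r = trans (∣∣-split (λ _ → true) (p ∘ lookup r)) (∣all∣ m)
    in-T : ∣ T ∩ p ∣ + ∣ T ∩ (not ∘ p) ∣ ≡ m
    in-T = trans (∣∣-split T p) ∣T∣

  higher : (Fin n → Bool) → Fin n → ℕ
  higher S x = ∣ S ∩ (x <ᶠ_) ∣

  occurrences-higher : ∀ (r : Vec (Fin n) m) S x → injectsInto (S ∖ x) r ≡ true → ∣ S ∖ x ∣ ≡ m →
                       occurrences (x <ᶠ_) r ≡ higher S x
  occurrences-higher r S x inj ∣S∖x∣ = begin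
    occurrences (x <ᶠ_) r                           ≡⟨ occurrences-≡ r (S ∖ x) (x <ᶠ_) inj ∣S∖x∣ ⟩
    ∣ (S ∖ x) ∩ (x <ᶠ_) ∣                           ≡⟨ +-identityʳ _ ⟨
    ∣ (S ∖ x) ∩ (x <ᶠ_) ∣ + 0                       ≡⟨ cong₂ _+_ (∣∣-cong (∖-∩-comm S (x <ᶠ_) x)) x≮x ⟨
    ∣ (S ∩ (x <ᶠ_)) ∖ x ∣ + bit (S x ∧ (x <ᶠ x))   ≡⟨ ∣∣-remove (S ∩ (x <ᶠ_)) x ⟨
    higher S x                                      ∎
    where
    open ≡-Reasoning
    x≮x : bit (S x ∧ (x <ᶠ x)) ≡ 0
    x≮x = cong bit (trans (cong (S x ∧_) (<ᵇ-false (≤-refl {toℕ x}))) (∧-zeroʳ (S x)))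

  higher-zero : ∀ (S : Fin (suc n) → Bool) → higher S zero ≡ ∣ S ∘ suc ∣
  higher-zero S = cong₂ _+_ (cong bit (∧-zeroʳ (S zero))) (∣∣-cong λ z → ∧-identityʳ (S (suc z)))

  higher-suc : ∀ (S : Fin (suc n) → Bool) x → higher S (suc x) ≡ higher (S ∘ suc) x
  higher-suc S x = cong (λ b → bit b + higher (S ∘ suc) x) (∧-zeroʳ (S zero))

open Words

module Weights {c ℓ} (R : CommutativeSemiring c ℓ) (θ : CommutativeSemiring.Carrier R) where
  open CommutativeSemiring R hiding (zero) renaming (refl to ≈-refl; sym to ≈-sym; trans to ≈-trans)
  open FinSum +-commutativeMonoid using (sum; sum-syntax; sum-cong-≋; ∑-comm; foldr-map-tabulate)
  open import Algebra.Properties.Semiring.Sum semiring using (*-distribˡ-sum; *-distribʳ-sum)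
  open import Relation.Binary.Reasoning.Setoid setoid

  unless : Bool → Carrier → Carrier
  unless b x = if b then 0# else x

  unless-cong : ∀ b {x y} → x ≈ y → unless b x ≈ unless b y
  unless-cong true  _   = ≈-refl
  unless-cong false x≈y = x≈y

  unless-∨-* : ∀ a b x y → unless (a ∨ b) (x * y) ≈ unless a x * unless b y
  unless-∨-* true  b     x y = ≈-sym (zeroˡ _)
  unless-∨-* false true  x y = ≈-sym (zeroʳ _)
  unless-∨-* false false x y = ≈-refl

  pow-+ : ∀ i j → pow R θ (i ℕ.+ j) ≈ pow R θ i * pow R θ j
  pow-+ zero    j = ≈-sym (*-identityˡ _)
  pow-+ (suc i) j = ≈-trans (*-congˡ (pow-+ i j)) (≈-sym (*-assoc _ _ _))

  weight : ℕ → Vec (Fin n) m → Carrier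
  weight k w = unless (pickable′ k w) (pow R θ (inv′ w))

  stepWeight : ℕ → ℕ → ℕ → Carrier
  stepWeight k m g = unless (not (m <ᵇ k) ∧ (g ≡ᵇ 1)) (pow R θ g)

  weight-∷ʳ : ∀ k (r : Vec (Fin n) m) x →
              weight k (r ∷ʳ x) ≈ weight k r * stepWeight k m (occurrences (x <ᶠ_) r)
  weight-∷ʳ {m = m} k r x = begin
    unless (pickable′ k (r ∷ʳ x)) (pow R θ (inv′ (r ∷ʳ x)))
      ≡⟨ cong₂ (λ b i → unless b (pow R θ i)) (pickable′-∷ʳ k r x) (inv′-∷ʳ r x) ⟩
    unless (pickable′ k r ∨ picksLast) (pow R θ (inv′ r ℕ.+ g))
      ≈⟨ unless-cong (pickable′ k r ∨ picksLast) (pow-+ (inv′ r) g) ⟩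
    unless (pickable′ k r ∨ picksLast) (pow R θ (inv′ r) * pow R θ g)
      ≈⟨ unless-∨-* (pickable′ k r) picksLast _ _ ⟩
    weight k r * stepWeight k m g ∎
    where
    g = occurrences (x <ᶠ_) r
    picksLast = not (m <ᵇ k) ∧ (g ≡ᵇ 1)

  weightIn : ℕ → (Fin n → Bool) → Vec (Fin n) m → Carrier
  weightIn k S w = if injectsInto S w then weight k w else 0#

  weightIn-∷ʳ : ∀ k (S : Fin n → Bool) → ∣ S ∣ ≡ suc m → ∀ (r : Vec (Fin n) m) x →
                weightIn k S (r ∷ʳ x) ≈ weightIn k (S ∖ x) r * (if S x then stepWeight k m (higher S x) else 0#)
  weightIn-∷ʳ {m = m} k S ∣S∣ r x rewrite injectsInto-∷ʳ S r x with S x in Sx | injectsInto (S ∖ x) r in inj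
  ... | false | _     = ≈-sym (zeroʳ _)
  ... | true  | false = ≈-sym (zeroˡ _)
  ... | true  | true  = ≈-trans (weight-∷ʳ k r x)
    (*-congˡ (reflexive (cong (stepWeight k m) (occurrences-higher r S x inj (∣∖∣ S Sx ∣S∣)))))

  sumWords : ∀ m → (Vec (Fin n) m → Carrier) → Carrier
  sumWords zero    G = G []
  sumWords (suc m) G = ∑[ a < _ ] sumWords m (λ w → G (a ∷ w))

  sumWords-cong : ∀ m {G H : Vec (Fin n) m → Carrier} → (∀ w → G w ≈ H w) → sumWords m G ≈ sumWords m H
  sumWords-cong zero    G≈H = G≈H []
  sumWords-cong (suc m) G≈H = sum-cong-≋ λ a → sumWords-cong m (G≈H ∘ (a ∷_))

  sumWords-∷ʳ : ∀ m (G : Vec (Fin n) (suc m) → Carrier) →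
                sumWords (suc m) G ≈ sumWords m (λ r → ∑[ x < n ] G (r ∷ʳ x))
  sumWords-∷ʳ zero    G = ≈-refl
  sumWords-∷ʳ (suc m) G = sum-cong-≋ λ a → sumWords-∷ʳ m (G ∘ (a ∷_))

  sumWords-comm : ∀ m {k} (F : Vec (Fin n) m → Fin k → Carrier) →
                  sumWords m (λ r → ∑[ x < k ] F r x) ≈ ∑[ x < k ] sumWords m (λ r → F r x)
  sumWords-comm zero    F = ≈-refl
  sumWords-comm (suc m) F = begin
    ∑[ a < _ ] sumWords m (λ w → ∑[ x < _ ] F (a ∷ w) x)
      ≈⟨ sum-cong-≋ (λ a → sumWords-comm m (F ∘ (a ∷_))) ⟩
    ∑[ a < _ ] ∑[ x < _ ] sumWords m (λ w → F (a ∷ w) x)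
      ≈⟨ ∑-comm (λ a x → sumWords m (λ w → F (a ∷ w) x)) ⟩
    ∑[ x < _ ] ∑[ a < _ ] sumWords m (λ w → F (a ∷ w) x) ∎

  sumWords-*ʳ : ∀ m (G : Vec (Fin n) m → Carrier) y → sumWords m (λ r → G r * y) ≈ sumWords m G * y
  sumWords-*ʳ zero    G y = ≈-refl
  sumWords-*ʳ (suc m) G y = ≈-trans (sum-cong-≋ λ a → sumWords-*ʳ m (G ∘ (a ∷_)) y)
                                    (≈-sym (*-distribʳ-sum y (λ a → sumWords m (G ∘ (a ∷_)))))

  sumBelow : ℕ → (ℕ → Carrier) → Carrier
  sumBelow zero    h = 0#
  sumBelow (suc c) h = sumBelow c h + h c

  sumBelow-cong : ∀ c {h h′ : ℕ → Carrier} → (∀ g → h g ≡ h′ g) → sumBelow c h ≈ sumBelow c h′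
  sumBelow-cong zero    _    = ≈-refl
  sumBelow-cong (suc c) h≡h′ = +-cong (sumBelow-cong c h≡h′) (reflexive (h≡h′ c))

  sum-higher : ∀ {n} (S : Fin n → Bool) h →
               ∑[ x < n ] (if S x then h (higher S x) else 0#) ≈ sumBelow (∣ S ∣) h
  sum-higher {zero}  S h = ≈-refl
  sum-higher {suc n} S h = begin
    atZero (higher S zero) + (∑[ x < n ] (if S (suc x) then h (higher S (suc x)) else 0#))
      ≈⟨ +-congˡ (sum-cong-≋ λ x → reflexive (cong (λ g → if S (suc x) then h g else 0#) (higher-suc S x))) ⟩
    atZero (higher S zero) + (∑[ x < n ] (if S (suc x) then h (higher (S ∘ suc) x) else 0#))
      ≈⟨ +-congˡ (sum-higher (S ∘ suc) h) ⟩
    atZero (higher S zero) + sumBelow (∣ S ∘ suc ∣) h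
      ≡⟨ cong (λ g → atZero g + sumBelow (∣ S ∘ suc ∣) h) (higher-zero S) ⟩
    atZero (∣ S ∘ suc ∣) + sumBelow (∣ S ∘ suc ∣) h
      ≈⟨ prepend (S zero) ⟩
    sumBelow (∣ S ∣) h ∎
    where
    atZero : ℕ → Carrier
    atZero g = if S zero then h g else 0#
    prepend : ∀ b → (if b then h (∣ S ∘ suc ∣) else 0#) + sumBelow (∣ S ∘ suc ∣) h
                    ≈ sumBelow (bit b ℕ.+ (∣ S ∘ suc ∣)) h
    prepend true  = +-comm _ _
    prepend false = +-identityˡ _

  stepFactor : ℕ → ℕ → Carrier
  stepFactor k j = sumBelow (suc j) (stepWeight k j)

  sumWords-weightIn : ∀ k m (S : Fin n → Bool) → ∣ S ∣ ≡ m →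
                      sumWords m (weightIn k S) ≈ prodR R m (stepFactor k)
  sumWords-weightIn k zero    S _   = ≈-refl
  sumWords-weightIn {n} k (suc m) S ∣S∣ = begin
    sumWords (suc m) (weightIn k S)
      ≈⟨ sumWords-∷ʳ m (weightIn k S) ⟩
    sumWords m (λ r → ∑[ x < n ] weightIn k S (r ∷ʳ x))
      ≈⟨ sumWords-cong m (λ r → sum-cong-≋ (weightIn-∷ʳ k S ∣S∣ r)) ⟩
    sumWords m (λ r → ∑[ x < n ] (weightIn k (S ∖ x) r * step x))
      ≈⟨ sumWords-comm m (λ r x → weightIn k (S ∖ x) r * step x) ⟩
    ∑[ x < n ] sumWords m (λ r → weightIn k (S ∖ x) r * step x)
      ≈⟨ sum-cong-≋ (λ x → ≈-trans (sumWords-*ʳ m (weightIn k (S ∖ x)) (step x)) (per-letter x)) ⟩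
    ∑[ x < n ] (prodR R m (stepFactor k) * step x)
      ≈⟨ *-distribˡ-sum (prodR R m (stepFactor k)) step ⟨
    prodR R m (stepFactor k) * (∑[ x < n ] step x)
      ≈⟨ *-congˡ (sum-higher S (stepWeight k m)) ⟩
    prodR R m (stepFactor k) * sumBelow (∣ S ∣) (stepWeight k m)
      ≡⟨ cong (λ c → prodR R m (stepFactor k) * sumBelow c (stepWeight k m)) ∣S∣ ⟩
    prodR R (suc m) (stepFactor k) ∎
    where
    step : Fin n → Carrier
    step x = if S x then stepWeight k m (higher S x) else 0#
    per-letter : ∀ x → sumWords m (weightIn k (S ∖ x)) * step x ≈ prodR R m (stepFactor k) * step x
    per-letter x with S x in Sx
    ... | true  = *-congʳ (sumWords-weightIn k m (S ∖ x) (∣∖∣ S Sx ∣S∣))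
    ... | false = ≈-trans (zeroʳ _) (≈-sym (zeroʳ _))

  sumR-++ : ∀ (xs ys : List Carrier) → sumR R (xs ++ ys) ≈ sumR R xs + sumR R ys
  sumR-++ []       ys = ≈-sym (+-identityˡ _)
  sumR-++ (x ∷ xs) ys = ≈-trans (+-congˡ (sumR-++ xs ys)) (≈-sym (+-assoc _ _ _))

  sumR-map-concatMap : ∀ (G : B → Carrier) (f : A → List B) xs →
                       sumR R (map G (concatMap f xs)) ≈ sumR R (map (λ x → sumR R (map G (f x))) xs)
  sumR-map-concatMap G f []       = ≈-refl
  sumR-map-concatMap G f (x ∷ xs) = begin
    sumR R (map G (f x ++ concatMap f xs))                   ≡⟨ cong (sumR R) (map-++ G (f x) (concatMap f xs)) ⟩
    sumR R (map G (f x) ++ map G (concatMap f xs))           ≈⟨ sumR-++ (map G (f x)) _ ⟩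
    sumR R (map G (f x)) + sumR R (map G (concatMap f xs))   ≈⟨ +-congˡ (sumR-map-concatMap G f xs) ⟩
    sumR R (map (λ x → sumR R (map G (f x))) (x ∷ xs))       ∎

  sumR-map-filter : ∀ (b : A → Bool) (G : A → Carrier) xs →
                    sumR R (map G (filter (λ x → T? (b x)) xs)) ≈ sumR R (map (λ x → if b x then G x else 0#) xs)
  sumR-map-filter b G []       = ≈-refl
  sumR-map-filter b G (x ∷ xs) with b x
  ... | true  = +-congˡ (sumR-map-filter b G xs)
  ... | false = ≈-trans (sumR-map-filter b G xs) (≈-sym (+-identityˡ _))

  sumR-allVecs : ∀ {n} m (G : Vec (Fin n) m → Carrier) → sumR R (map G (allVecs n m)) ≈ sumWords m G
  sumR-allVecs zero    G = +-identityʳ (G [])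
  sumR-allVecs {n} (suc m) G = begin
    sumR R (map G (concatMap (λ a → map (a ∷_) (allVecs n m)) (allFin n)))
      ≈⟨ sumR-map-concatMap G (λ a → map (a ∷_) (allVecs n m)) (allFin n) ⟩
    sumR R (map (λ a → sumR R (map G (map (a ∷_) (allVecs n m)))) (allFin n))
      ≡⟨ foldr-map-tabulate (λ a → sumR R (map G (map (a ∷_) (allVecs n m)))) id ⟩
    ∑[ a < n ] sumR R (map G (map (a ∷_) (allVecs n m)))
      ≈⟨ sum-cong-≋ (λ a → ≈-trans (reflexive (cong (sumR R) (sym (map-∘ (allVecs n m)))))
                                   (sumR-allVecs m (G ∘ (a ∷_)))) ⟩
    sumWords (suc m) G ∎

  T2-sumWords : ∀ N k → T2 R θ N k ≈ sumWords N (weightIn k (λ _ → true))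
  T2-sumWords N k = begin
    T2 R θ N k                             ≈⟨ sumR-map-filter (not ∘ pickable k) (pow R θ ∘ inv) (Sym N) ⟩
    sumR R (map nonPickable (Sym N))       ≈⟨ sumR-map-filter isPerm nonPickable (allVecs N N) ⟩
    sumR R (map filtered (allVecs N N))    ≈⟨ sumR-allVecs N filtered ⟩
    sumWords N filtered                    ≈⟨ sumWords-cong N (reflexive ∘ filtered-weightIn) ⟩
    sumWords N (weightIn k (λ _ → true))   ∎
    where
    nonPickable filtered : Vec (Fin N) N → Carrier
    nonPickable π = if not (pickable k π) then pow R θ (inv π) else 0#
    filtered π = if isPerm π then nonPickable π else 0#
    filtered-weightIn : ∀ π → filtered π ≡ weightIn k (λ _ → true) π
    filtered-weightIn π = trans (guards (isPerm π) (pickable k π) (pow R θ (inv π)))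
      (cong (λ b → if isPerm π ∧ b then weight k π else 0#) (sym (∧Σ.sum-replicate-zero N)))
      where
      guards : ∀ p q x → (if p then (if not q then x else 0#) else 0#) ≡ (if p ∧ true then unless q x else 0#)
      guards true  true  x = refl
      guards true  false x = refl
      guards false q     x = refl

  T2-prodR : ∀ N k → T2 R θ N k ≈ prodR R N (stepFactor k)
  T2-prodR N k = ≈-trans (T2-sumWords N k) (sumWords-weightIn k N (λ _ → true) (∣all∣ N))

  sumBelow-pow : ∀ c → sumBelow c (pow R θ) ≈ P R θ c
  sumBelow-pow zero    = ≈-refl
  sumBelow-pow (suc c) = +-congʳ (sumBelow-pow c)

  sumBelow-pow-without-1 : ∀ j →
                           sumBelow (2 ℕ.+ j) (λ g → unless (g ≡ᵇ 1) (pow R θ g)) ≈ 1# + (θ * θ) * P R θ j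
  sumBelow-pow-without-1 zero = begin
    0# + 1# + 0#        ≈⟨ +-congʳ (+-identityˡ 1#) ⟩
    1# + 0#             ≈⟨ +-congˡ (zeroʳ (θ * θ)) ⟨
    1# + (θ * θ) * 0#   ∎
  sumBelow-pow-without-1 (suc j) = begin
    sumBelow (2 ℕ.+ j) _ + θ * (θ * pow R θ j)       ≈⟨ +-congʳ (sumBelow-pow-without-1 j) ⟩
    1# + (θ * θ) * P R θ j + θ * (θ * pow R θ j)     ≈⟨ +-assoc _ _ _ ⟩
    1# + ((θ * θ) * P R θ j + θ * (θ * pow R θ j))   ≈⟨ +-congˡ (+-congˡ (*-assoc θ θ (pow R θ j))) ⟨
    1# + ((θ * θ) * P R θ j + (θ * θ) * pow R θ j)   ≈⟨ +-congˡ (distribˡ (θ * θ) _ _) ⟨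
    1# + (θ * θ) * P R θ (suc j)                     ∎

  stepFactor-below : ∀ {k j} → j < k → stepFactor k j ≈ P R θ (suc j)
  stepFactor-below {k} {j} j<k = ≈-trans
    (sumBelow-cong (suc j) λ g → cong (λ b → unless (not b ∧ (g ≡ᵇ 1)) (pow R θ g)) (<ᵇ-true j<k))
    (sumBelow-pow (suc j))

  stepFactor-above : ∀ k t → stepFactor (suc k) (suc (k ℕ.+ t)) ≈ 1# + (θ * θ) * P R θ (k ℕ.+ t)
  stepFactor-above k t = ≈-trans
    (sumBelow-cong (2 ℕ.+ (k ℕ.+ t)) λ g →
      cong (λ b → unless (not b ∧ (g ≡ᵇ 1)) (pow R θ g)) (<ᵇ-false (ℕₚ.m≤m+n k t)))
    (sumBelow-pow-without-1 (k ℕ.+ t))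

  prodR-cong : ∀ m {f g : ℕ → Carrier} → (∀ t → t < m → f t ≈ g t) → prodR R m f ≈ prodR R m g
  prodR-cong zero    _   = ≈-refl
  prodR-cong (suc m) f≈g = *-cong (prodR-cong m λ t t<m → f≈g t (ℕₚ.m<n⇒m<1+n t<m)) (f≈g m ℕₚ.≤-refl)

  prodR-+ : ∀ m d (f : ℕ → Carrier) → prodR R (m ℕ.+ d) f ≈ prodR R m f * prodR R d (λ t → f (m ℕ.+ t))
  prodR-+ m zero    f rewrite ℕₚ.+-identityʳ m = ≈-sym (*-identityʳ _)
  prodR-+ m (suc d) f rewrite ℕₚ.+-suc m d = ≈-trans (*-congʳ (prodR-+ m d f)) (*-assoc _ _ _)

  Pfact-prodR : ∀ m → Pfact R θ m ≈ prodR R m (λ j → P R θ (suc j))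
  Pfact-prodR zero    = ≈-refl
  Pfact-prodR (suc m) = ≈-trans (*-comm _ _) (*-congʳ (Pfact-prodR m))

  prodR-stepFactor : ∀ k → prodR R k (stepFactor k) ≈ Pfact R θ k
  prodR-stepFactor k = ≈-trans (prodR-cong k (λ _ → stepFactor-below)) (≈-sym (Pfact-prodR k))

  T2-diagonal : ∀ k → T2 R θ k k ≈ Pfact R θ k
  T2-diagonal k = ≈-trans (T2-prodR k k) (prodR-stepFactor k)

  T2-beyond : ∀ k N → 1 ≤ k → k ℕ.+ 1 ≤ N →
              T2 R θ N k ≈ Pfact R θ k * prodR R (N ∸ k) (λ t → 1# + (θ * θ) * P R θ ((k ∸ 1) ℕ.+ t))
  T2-beyond (suc k) N _ k+1≤N with ℕₚ.m≤n⇒∃[o]m+o≡n (ℕₚ.≤-trans (ℕₚ.m≤m+n (suc k) 1) k+1≤N)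
  ... | d , refl rewrite ℕₚ.m+n∸m≡n (suc k) d = begin
    T2 R θ (suc k ℕ.+ d) (suc k)
      ≈⟨ T2-prodR (suc k ℕ.+ d) (suc k) ⟩
    prodR R (suc k ℕ.+ d) (stepFactor (suc k))
      ≈⟨ prodR-+ (suc k) d (stepFactor (suc k)) ⟩
    prodR R (suc k) (stepFactor (suc k)) * prodR R d (λ t → stepFactor (suc k) (suc k ℕ.+ t))
      ≈⟨ *-cong (prodR-stepFactor (suc k)) (prodR-cong d (λ t _ → stepFactor-above k t)) ⟩
    Pfact R θ (suc k) * prodR R d (λ t → 1# + (θ * θ) * P R θ (k ℕ.+ t)) ∎

lemma8 : ∀ {c ℓ} (R : CommutativeSemiring c ℓ) (θ : CommutativeSemiring.Carrier R) →
    let open CommutativeSemiring R in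
    (∀ (k : ℕ) → T2 R θ k k ≈ Pfact R θ k)
    × (∀ (k N : ℕ) → 1 ≤ k → k ℕ.+ 1 ≤ N →
         T2 R θ N k ≈ Pfact R θ k * prodR R (N ∸ k) (λ t → 1# + (θ * θ) * P R θ ((k ∸ 1) ℕ.+ t)))
lemma8 R θ = T2-diagonal , T2-beyond
  where open Weights R θ
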